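{- Consider a run (derivation) of the abstract Simplex calculus described in the context, starting from a configuration $\langle \mathcal{B}, A, l, u, \alpha\rangle$ over variables $\mathcal{X}=\{x_1,\dots,x_n\}$. If the derivation ends in the state $\texttt{UNSAT}$, then Simplex has discovered a variable $x_i\in\mathcal{X}$ with contradicting bounds, i.e. a variable for which $l(x_i) > u(x_i)$, where $l(x_i)$, $u(x_i)$ are either the bounds stored in the configuration, or a bound of $x_i$ together with the opposite bound that is implied for $x_i$ by its tableau row $x_i=\sum_{x_j\notin\mathcal{B}} c_j x_j$ (namely $\sum_{c_j>0} c_j u(x_j)+\sum_{c_j<0} c_j l(x_j)$ as an upper bound, or $\sum_{c_j>0} c_j l(x_j)+\sum_{c_j<0} c_j u(x_j)$ as a lower bound).
   Context: A Simplex configuration is either one of the symbols $\texttt{SAT}$, $\texttt{UNSAT}$, or a tuple $\langle \mathcal{B}, A, l, u, \alpha\rangle$ where $\mathcal{B}\subseteq\mathcal{X}$ is the set of basic variables; the tableau $A$ contains for each $x_i\in\mathcal{B}$ an equation $x_i=\sum_{x_j\notin\mathcal{B}} c_j x_j$ (we write $A_{i,j}=c_j$); $l,u$ assign to each variable a lower and an upper bound in $\mathbb{R}\cup\{\pm\infty\}$; and $\alpha$ assigns each variable a real value. Define $\mathrm{slack}^+(x_i)=\{x_j\notin\mathcal{B} : (A_{i,j}>0\wedge \alpha(x_j)<u(x_j))\vee(A_{i,j}<0\wedge\alpha(x_j)>l(x_j))\}$ and $\mathrm{slack}^-(x_i)=\{x_j\notin\mathcal{B} : (A_{i,j}<0\wedge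 \alpha(x_j)<u(x_j))\vee(A_{i,j}>0\wedge\alpha(x_j)>l(x_j))\}$. The derivation rules are: Pivot$_1$: if $x_i\in\mathcal{B}$, $\alpha(x_i)<l(x_i)$, $x_j\in\mathrm{slack}^+(x_i)$, then pivot $x_i$ out and $x_j$ in (rewriting the tableau by solving row $i$ for $x_j$ and substituting); Pivot$_2$: same with $\alpha(x_i)>u(x_i)$ and $x_j\in\mathrm{slack}^-(x_i)$; Update: for $x_j\notin\mathcal{B}$ with $\alpha(x_j)$ out of bounds and $l(x_j)\le\alpha(x_j)+\delta\le u(x_j)$, set $\alpha(x_j):=\alpha(x_j)+\delta$ and $\alpha(x_i):=\alpha(x_i)+\delta A_{i,j}$ for basic $x_i$; Failure$_1$: if $x_i\in\mathcal{B}$ and either ($\alpha(x_i)<l(x_i)$ and $\mathrm{slack}^+(x_i)=\emptyset$) or ($\alpha(x_i)>u(x_i)$ and $\mathrm{slack}^-(x_i)=\emptyset$), derive $\texttt{UNSAT}$; Failure$_2$: if $l(x_i)>u(x_i)$ for some $x_i$, derive $\texttt{UNSAT}$; Success: if all variables satisfy $l(x_i)\le\alpha(x_i)\le u(x_i)$, derive $\texttt{SAT}$. Throughout, the assignment $\alpha$ satisfies all tableau equations.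
   Formalization: The assignment α, the tableau coefficients $A_{i,j}$ and the finite values of the bounds l, u are rational rather than real. -}

module Defs where

open import Data.Bool using (Bool; true; false; if_then_else_; _∧_; not)
open import Data.Fin using (Fin; _≟_)
open import Data.List using (List; foldr; map)
open import Data.Fin.Base using ()
open import Data.List.Base using ()
open import Data.Rational using (ℚ; 0ℚ; _+_; _*_; _-_; -_; 1/_; _<_; _≤_; ≢-nonZero)
open import Data.Rational.Properties using (_<?_) renaming (_≟_ to _≟ℚ_)
open import Data.Product using (_×_; ∃-syntax; Σ-syntax)
open import Data.Sum using (_⊎_)
open import Data.Nat using (ℕ)
open import Relation.Nullary using (¬_; yes; no; does)
open import Relation.Binary.PropositionalEquality using (_≡_; _≢_)
open import Relation.Binary.Construct.Closure.ReflexiveTransitive using (Star)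
import Data.List as L

data ℚ̄ : Set where
  -∞  : ℚ̄
  fin : ℚ → ℚ̄
  +∞  : ℚ̄

infix 4 _<̄_ _≤̄_

data _<̄_ : ℚ̄ → ℚ̄ → Set where
  -∞<fin : ∀ {q} → -∞ <̄ fin q
  -∞<+∞  : -∞ <̄ +∞
  fin<fin : ∀ {p q} → p < q → fin p <̄ fin q
  fin<+∞ : ∀ {q} → fin q <̄ +∞

data _≤̄_ : ℚ̄ → ℚ̄ → Set where
  -∞≤ : ∀ {x} → -∞ ≤̄ x
  fin≤fin : ∀ {p q} → p ≤ q → fin p ≤̄ fin q
  ≤+∞ : ∀ {x} → x ≤̄ +∞

-- scaling an extended value by a nonzero rational
scale : ℚ → ℚ̄ → ℚ̄
scale c (fin q) = fin (c * q)
scale c +∞ = if does (0ℚ <? c) then +∞ else -∞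
scale c -∞ = if does (0ℚ <? c) then -∞ else +∞

-- Addition for implied UPPER bounds: +∞ absorbs (an undefined sum
-- +∞ + -∞ is treated as the trivial upper bound +∞).
_⊕⁺_ : ℚ̄ → ℚ̄ → ℚ̄
+∞ ⊕⁺ _ = +∞
_ ⊕⁺ +∞ = +∞
-∞ ⊕⁺ _ = -∞
_ ⊕⁺ -∞ = -∞
fin a ⊕⁺ fin b = fin (a + b)

-- Addition for implied LOWER bounds: -∞ absorbs.
_⊕⁻_ : ℚ̄ → ℚ̄ → ℚ̄
-∞ ⊕⁻ _ = -∞
_ ⊕⁻ -∞ = -∞
+∞ ⊕⁻ _ = +∞
_ ⊕⁻ +∞ = +∞
fin a ⊕⁻ fin b = fin (a + b)

Σℚ : ∀ {n} → (Fin n → ℚ) → ℚ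
Σℚ {n} f = foldr _+_ 0ℚ (map f (L.allFin n))

Σ⁺ : ∀ {n} → (Fin n → ℚ̄) → ℚ̄
Σ⁺ {n} f = foldr _⊕⁺_ (fin 0ℚ) (map f (L.allFin n))

Σ⁻ : ∀ {n} → (Fin n → ℚ̄) → ℚ̄
Σ⁻ {n} f = foldr _⊕⁻_ (fin 0ℚ) (map f (L.allFin n))

-- total inverse (only used at nonzero arguments)
inv : ℚ → ℚ
inv p with p ≟ℚ 0ℚ
... | yes _ = 0ℚ
... | no p≢0 = 1/_ p {{≢-nonZero p≢0}}

record Config (n : ℕ) : Set where
  field
    basic : Fin n → Bool          -- x ∈ 𝓑  iff  basic x ≡ true
    A     : Fin n → Fin n → ℚ     -- A i j, meaningful for basic i, nonbasic j
    l     : Fin n → ℚ̄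
    u     : Fin n → ℚ̄
    α     : Fin n → ℚ
open Config public

data State (n : ℕ) : Set where
  SAT   : State n
  UNSAT : State n
  ⟨_⟩   : Config n → State n

module _ {n : ℕ} (c : Config n) where

  Basic : Fin n → Set
  Basic x = basic c x ≡ true

  NonBasic : Fin n → Set
  NonBasic x = basic c x ≡ false

  rowVal : Fin n → (Fin n → ℚ) → ℚ
  rowVal i β = Σℚ (λ j → if basic c j then 0ℚ else A c i j * β j)

  TableauSat : Set
  TableauSat = ∀ i → Basic i → α c i ≡ rowVal i (α c)

  slack⁺ : Fin n → Fin n → Set
  slack⁺ i j = NonBasic j ×
    ((0ℚ < A c i j × fin (α c j) <̄ u c j) ⊎ (A c i j < 0ℚ × l c j <̄ fin (α c j)))

  slack⁻ : Fin n → Fin n → Set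
  slack⁻ i j = NonBasic j ×
    ((A c i j < 0ℚ × fin (α c j) <̄ u c j) ⊎ (0ℚ < A c i j × l c j <̄ fin (α c j)))

  impliedUpper : Fin n → ℚ̄
  impliedUpper i = Σ⁺ (λ j →
    if basic c j then fin 0ℚ
    else if does (0ℚ <? A c i j) then scale (A c i j) (u c j)
    else if does (A c i j <? 0ℚ) then scale (A c i j) (l c j)
    else fin 0ℚ)

  impliedLower : Fin n → ℚ̄
  impliedLower i = Σ⁻ (λ j →
    if basic c j then fin 0ℚ
    else if does (0ℚ <? A c i j) then scale (A c i j) (l c j)
    else if does (A c i j <? 0ℚ) then scale (A c i j) (u c j)
    else fin 0ℚ)

  Conflict : Fin n → Set
  Conflict i = (u c i <̄ l c i)
             ⊎ (Basic i × impliedUpper i <̄ l c i)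
             ⊎ (Basic i × u c i <̄ impliedLower i)

  pivoted : Fin n → Fin n → Config n
  pivoted i j = record
    { basic = λ x → if does (x ≟ i) then false else if does (x ≟ j) then true else basic c x
    ; A = A'
    ; l = l c ; u = u c ; α = α c }
    where
      a = A c i j
      A' : Fin n → Fin n → ℚ
      A' r k with does (r ≟ j) | basic c r ∧ not (does (r ≟ i)) | does (k ≟ i)
      ... | true  | _     | true  = inv a
      ... | true  | _     | false = - (A c i k * inv a)
      ... | false | true  | true  = A c r j * inv a
      ... | false | true  | false = A c r k - A c r j * A c i k * inv a
      ... | false | false | _     = A c r k

  updated : Fin n → ℚ → Config n
  updated j δ = record
    { basic = basic c ; A = A c ; l = l c ; u = u c
    ; α = λ x → if does (x ≟ j) then α c x + δ
                else if basic c x then α c x + δ * A c x j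
                else α c x }

infix 4 _⟶_
data _⟶_ {n : ℕ} : State n → State n → Set where
  pivot₁ : ∀ {c i j} → Basic c i → fin (α c i) <̄ l c i → slack⁺ c i j →
           ⟨ c ⟩ ⟶ ⟨ pivoted c i j ⟩
  pivot₂ : ∀ {c i j} → Basic c i → u c i <̄ fin (α c i) → slack⁻ c i j →
           ⟨ c ⟩ ⟶ ⟨ pivoted c i j ⟩
  update : ∀ {c j} δ → NonBasic c j →
           (fin (α c j) <̄ l c j ⊎ u c j <̄ fin (α c j)) →
           l c j ≤̄ fin (α c j + δ) → fin (α c j + δ) ≤̄ u c j →
           ⟨ c ⟩ ⟶ ⟨ updated c j δ ⟩
  failure₁ : ∀ {c i} → Basic c i →
           ((fin (α c i) <̄ l c i × (∀ j → ¬ slack⁺ c i j))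
            ⊎ (u c i <̄ fin (α c i) × (∀ j → ¬ slack⁻ c i j))) →
           ⟨ c ⟩ ⟶ UNSAT
  failure₂ : ∀ {c i} → u c i <̄ l c i → ⟨ c ⟩ ⟶ UNSAT
  success : ∀ {c} → (∀ i → l c i ≤̄ fin (α c i) × fin (α c i) ≤̄ u c i) →
           ⟨ c ⟩ ⟶ SAT

infix 4 _⟶*_
_⟶*_ : ∀ {n} → State n → State n → Set
_⟶*_ = Star _⟶_

{-# OPTIONS --safe #-}

-- The tableau equations are an invariant of every run. An Update moves α along a vector that
-- itself solves the (homogeneous) tableau, and a Pivot replaces each row form Σ A r k x_k - x_r
-- by a linear combination of old row forms, which still vanish at α. So when Failure₁ fires on
-- a basic x_i with α(x_i) < l(x_i), the row of x_i holds at α, and the absence of slack says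
-- that every x_j with c_j > 0 sits at or above u(x_j) and every x_j with c_j < 0 at or below
-- l(x_j); hence the implied upper bound Σ_{c_j>0} c_j u(x_j) + Σ_{c_j<0} c_j l(x_j) is at most
-- Σ c_j α(x_j) = α(x_i) < l(x_i). The case α(x_i) > u(x_i) is symmetric.
module Submission where

open import Defs
open import Algebra.Bundles using (CommutativeRing)
open import Data.Bool using (true; false; if_then_else_)
open import Data.Empty using (⊥-elim)
open import Data.Fin using (Fin; zero; suc; _≟_; punchIn)
open import Data.Fin.Properties using (punchInᵢ≢i)
import Data.List as List
open import Data.List.Properties using (map-tabulate; map-cong)
open import Data.Nat using (ℕ; zero; suc)
open import Data.Product using (_×_; ∃-syntax; _,_; proj₁; proj₂)
open import Data.Rational using (ℚ; 0ℚ; 1ℚ; _+_; _*_; _-_; -_; _<_; ≢-nonZero; positive; negative)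
open import Data.Rational.Properties
  using ( _<?_; ≤-refl; ≤-reflexive; ≤-antisym; ≮⇒≥; <-asym; <⇒≢; ≤-<-trans; <-≤-trans
        ; +-mono-≤; *-monoˡ-≤-nonNeg; *-monoˡ-≤-nonPos; pos⇒nonNeg; neg⇒nonPos
        ; +-identityʳ; *-zeroˡ; *-zeroʳ; *-identityʳ; *-assoc; *-distribʳ-+; *-inverseˡ; neg-distribˡ-*
        ; +-0-group; +-*-commutativeRing )
  renaming (_≟_ to _≟ℚ_)
open import Data.Rational.Solver using (module +-*-Solver)
open import Data.Sum using (_⊎_; inj₁; inj₂)
open import Data.Vec.Functional as Vector using (Vector; removeAt)
open import Function using (id; _∘_)
open import Relation.Binary.Construct.Closure.ReflexiveTransitive using (ε; _◅_)
open import Relation.Binary.PropositionalEquality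
  using (_≡_; _≢_; _≗_; refl; sym; trans; cong; cong₂; subst; module ≡-Reasoning)
open import Relation.Nullary using (¬_; Dec; yes; no; does)
open import Relation.Nullary.Decidable using (dec-true; dec-false)

open import Algebra.Properties.Group +-0-group using (x∙y⁻¹≈ε⇒x≈y; x≈y⇒x∙y⁻¹≈ε)
open import Algebra.Properties.Semiring.Sum (CommutativeRing.semiring +-*-commutativeRing)
  using (sum; sum-cong-≗; sum-remove; sum-replicate-zero; ∑-distrib-+; *-distribˡ-sum)

open +-*-Solver using (solve; _:=_; _:+_; _:*_; _:-_; :-_; con)
open ≡-Reasoning

module _ {X : Set} (op : X → X → X) (e : X) where

  foldr-tabulate : ∀ {n} (f : Vector X n) → List.foldr op e (List.tabulate f) ≡ Vector.foldr op e f
  foldr-tabulate {zero}  f = refl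
  foldr-tabulate {suc n} f = cong (op (f zero)) (foldr-tabulate (f ∘ suc))

  foldr-allFin : ∀ {n} (f : Vector X n) → List.foldr op e (List.map f (List.allFin n)) ≡ Vector.foldr op e f
  foldr-allFin f = trans (cong (List.foldr op e) (map-tabulate id f)) (foldr-tabulate f)

Σℚ≡sum : ∀ {n} (f : Vector ℚ n) → Σℚ f ≡ sum f
Σℚ≡sum = foldr-allFin _+_ 0ℚ

Σℚ-cong : ∀ {n} {f g : Vector ℚ n} → f ≗ g → Σℚ f ≡ Σℚ g
Σℚ-cong {n} f≗g = cong (List.foldr _+_ 0ℚ) (map-cong f≗g (List.allFin n))

sum-supported-at : ∀ {n} (t : Vector ℚ n) r → (∀ k → k ≢ r → t k ≡ 0ℚ) → sum t ≡ t r
sum-supported-at {suc n} t r t≡0 = begin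
  sum t                     ≡⟨ sum-remove {i = r} t ⟩
  t r + sum (removeAt t r)  ≡⟨ cong (t r +_) (trans (sum-cong-≗ t∘punchIn≡0) (sum-replicate-zero n)) ⟩
  t r + 0ℚ                  ≡⟨ +-identityʳ (t r) ⟩
  t r                       ∎
  where
  t∘punchIn≡0 : ∀ k → t (punchIn r k) ≡ 0ℚ
  t∘punchIn≡0 k = t≡0 (punchIn r k) (punchInᵢ≢i r k)

sum-cong-except : ∀ {n} {t s : Vector ℚ n} r → (∀ {k} → k ≢ r → t k ≡ s k) →
                  sum t ≡ sum s + (t r - s r)
sum-cong-except {suc n} {t} {s} r t≡s = begin
  sum t                                     ≡⟨ sum-remove {i = r} t ⟩
  t r + sum (removeAt t r)                  ≡⟨ cong (t r +_) (sum-cong-≗ (t≡s ∘ punchInᵢ≢i r)) ⟩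
  t r + sum (removeAt s r)                  ≡⟨ solve 3 (λ x y z → x :+ z := (y :+ z) :+ (x :- y))
                                                       refl (t r) (s r) (sum (removeAt s r)) ⟩
  (s r + sum (removeAt s r)) + (t r - s r)  ≡⟨ cong (_+ (t r - s r)) (sym (sum-remove {i = r} s)) ⟩
  sum s + (t r - s r)                       ∎

infix 7 _·_

_·_ : ∀ {n} → Vector ℚ n → Vector ℚ n → ℚ
f · β = sum (λ k → f k * β k)

·-congˡ : ∀ {n} {f g β : Vector ℚ n} → f ≗ g → f · β ≡ g · β
·-congˡ {β = β} f≗g = sum-cong-≗ (λ k → cong (_* β k) (f≗g k))

·-+ˡ : ∀ {n} (f g : Vector ℚ n) {β} → (λ k → f k + g k) · β ≡ f · β + g · β
·-+ˡ f g {β} = trans (sum-cong-≗ (λ k → *-distribʳ-+ (β k) (f k) (g k)))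
                     (∑-distrib-+ (λ k → f k * β k) (λ k → g k * β k))

·-*ˡ : ∀ {n} x (f : Vector ℚ n) {β} → (λ k → x * f k) · β ≡ x * (f · β)
·-*ˡ x f {β} = trans (sum-cong-≗ (λ k → *-assoc x (f k) (β k)))
                     (sym (*-distribˡ-sum x (λ k → f k * β k)))

module _ {n : ℕ} (c : Config n) where

  Basic⇒¬NonBasic : ∀ {x} → Basic c x → ¬ NonBasic c x
  Basic⇒¬NonBasic bx nbx with () ← trans (sym bx) nbx

  rowTerm : Fin n → Vector ℚ n → Vector ℚ n
  rowTerm r β k = if basic c k then 0ℚ else A c r k * β k

  SatisfiesTableau : Vector ℚ n → Set
  SatisfiesTableau β = ∀ r → Basic c r → β r ≡ rowVal c r β

  SatisfiesTableau-resp-≗ : ∀ {β γ} → β ≗ γ → SatisfiesTableau β → SatisfiesTableau γ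
  SatisfiesTableau-resp-≗ {β} {γ} β≗γ sat r br = begin
    γ r             ≡⟨ sym (β≗γ r) ⟩
    β r             ≡⟨ sat r br ⟩
    rowVal c r β    ≡⟨ Σℚ-cong (λ k → cong (λ v → if basic c k then 0ℚ else A c r k * v) (β≗γ k)) ⟩
    rowVal c r γ    ∎

  rowVal-linear : ∀ r β γ x → rowVal c r (λ k → β k + x * γ k) ≡ rowVal c r β + x * rowVal c r γ
  rowVal-linear r β γ x = begin
    rowVal c r (λ k → β k + x * γ k)
      ≡⟨ Σℚ≡sum (rowTerm r (λ k → β k + x * γ k)) ⟩
    sum (rowTerm r (λ k → β k + x * γ k))
      ≡⟨ sum-cong-≗ rowTerm-linear ⟩
    sum (λ k → rowTerm r β k + x * rowTerm r γ k)
      ≡⟨ ∑-distrib-+ (rowTerm r β) (λ k → x * rowTerm r γ k) ⟩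
    sum (rowTerm r β) + sum (λ k → x * rowTerm r γ k)
      ≡⟨ cong (sum (rowTerm r β) +_) (sym (*-distribˡ-sum x (rowTerm r γ))) ⟩
    sum (rowTerm r β) + x * sum (rowTerm r γ)
      ≡⟨ sym (cong₂ (λ p q → p + x * q) (Σℚ≡sum (rowTerm r β)) (Σℚ≡sum (rowTerm r γ))) ⟩
    rowVal c r β + x * rowVal c r γ
      ∎
    where
    rowTerm-linear : ∀ k → rowTerm r (λ k → β k + x * γ k) k ≡ rowTerm r β k + x * rowTerm r γ k
    rowTerm-linear k with basic c k
    ... | true  = solve 1 (λ x → con 0ℚ := con 0ℚ :+ x :* con 0ℚ) refl x
    ... | false = solve 4 (λ a b g x → a :* (b :+ x :* g) := a :* b :+ x :* (a :* g))
                          refl (A c r k) (β k) (γ k) x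

  SatisfiesTableau-linear : ∀ {β γ} → SatisfiesTableau β → SatisfiesTableau γ →
                            ∀ x → SatisfiesTableau (λ k → β k + x * γ k)
  SatisfiesTableau-linear {β} {γ} satβ satγ x r br =
    trans (cong₂ (λ p q → p + x * q) (satβ r br) (satγ r br)) (sym (rowVal-linear r β γ x))

  rowForm : Fin n → Vector ℚ n
  rowForm r k = if does (k ≟ r) then - 1ℚ else if basic c k then 0ℚ else A c r k

  rowForm·≡rowVal-β : ∀ {r β} → Basic c r → rowForm r · β ≡ rowVal c r β - β r
  rowForm·≡rowVal-β {r} {β} br = begin
    sum t                      ≡⟨ sum-cong-except r t≡s ⟩
    sum s + (t r - s r)        ≡⟨ cong₂ (λ x y → sum s + (x - y)) t[r] s[r] ⟩
    sum s + (- 1ℚ * β r - 0ℚ)  ≡⟨ solve 2 (λ y b → y :+ (:- con 1ℚ :* b :- con 0ℚ) := y :- b)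
                                          refl (sum s) (β r) ⟩
    sum s - β r                ≡⟨ cong (_- β r) (sym (Σℚ≡sum s)) ⟩
    rowVal c r β - β r         ∎
    where
    t = λ k → rowForm r k * β k
    s = rowTerm r β
    t[r] : t r ≡ - 1ℚ * β r
    t[r] with r ≟ r
    ... | yes _  = refl
    ... | no r≢r = ⊥-elim (r≢r refl)
    s[r] : s r ≡ 0ℚ
    s[r] rewrite br = refl
    t≡s : ∀ {k} → k ≢ r → t k ≡ s k
    t≡s {k} k≢r with k ≟ r | basic c k
    ... | yes k≡r | _     = ⊥-elim (k≢r k≡r)
    ... | no _    | true  = *-zeroˡ (β k)
    ... | no _    | false = refl

  SatisfiesTableau⇒rowForm·≡0 : ∀ {β r} → SatisfiesTableau β → Basic c r → rowForm r · β ≡ 0ℚ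
  SatisfiesTableau⇒rowForm·≡0 sat br = trans (rowForm·≡rowVal-β br) (x≈y⇒x∙y⁻¹≈ε (sym (sat _ br)))

  rowForm·≡0⇒row-equation : ∀ {β r} → Basic c r → rowForm r · β ≡ 0ℚ → β r ≡ rowVal c r β
  rowForm·≡0⇒row-equation br eq = sym (x∙y⁻¹≈ε⇒x≈y _ _ (trans (sym (rowForm·≡rowVal-β br)) eq))

updateDirection : ∀ {n} → Config n → Fin n → Vector ℚ n
updateDirection c j k = if does (k ≟ j) then 1ℚ else if basic c k then A c k j else 0ℚ

α-updated : ∀ {n} (c : Config n) j δ → α (updated c j δ) ≗ λ k → α c k + δ * updateDirection c j k
α-updated c j δ k with k ≟ j | basic c k
... | yes _ | _     = cong (α c k +_) (sym (*-identityʳ δ))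
... | no _  | true  = refl
... | no _  | false = sym (trans (cong (α c k +_) (*-zeroʳ δ)) (+-identityʳ (α c k)))

updateDirection-satisfies : ∀ {n} {c : Config n} {j} → NonBasic c j → SatisfiesTableau c (updateDirection c j)
updateDirection-satisfies {c = c} {j} nj r br = begin
  updateDirection c j r   ≡⟨ d[r] ⟩
  A c r j                 ≡⟨ sym (*-identityʳ (A c r j)) ⟩
  A c r j * 1ℚ            ≡⟨ sym t[j] ⟩
  t j                     ≡⟨ sym (sum-supported-at t j t≡0) ⟩
  sum t                   ≡⟨ sym (Σℚ≡sum t) ⟩
  rowVal c r (updateDirection c j) ∎
  where
  t = rowTerm c r (updateDirection c j)
  d[r] : updateDirection c j r ≡ A c r j
  d[r] with r ≟ j
  ... | yes refl = ⊥-elim (Basic⇒¬NonBasic c br nj)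
  ... | no _     rewrite br = refl
  t[j] : t j ≡ A c r j * 1ℚ
  t[j] rewrite nj with j ≟ j
  ... | yes _  = refl
  ... | no j≢j = ⊥-elim (j≢j refl)
  t≡0 : ∀ k → k ≢ j → t k ≡ 0ℚ
  t≡0 k k≢j with k ≟ j | basic c k
  ... | yes k≡j | _     = ⊥-elim (k≢j k≡j)
  ... | no _    | true  = refl
  ... | no _    | false = *-zeroʳ (A c r k)

updated-preserves-TableauSat : ∀ {n} {c : Config n} {j} δ → NonBasic c j →
                               TableauSat c → TableauSat (updated c j δ)
updated-preserves-TableauSat {c = c} {j} δ nj sat =
  SatisfiesTableau-resp-≗ c (sym ∘ α-updated c j δ)
    (SatisfiesTableau-linear c sat (updateDirection-satisfies {c = c} nj) δ)

inv-inverseˡ : ∀ p → p ≢ 0ℚ → inv p * p ≡ 1ℚ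
inv-inverseˡ p p≢0 with p ≟ℚ 0ℚ
... | yes p≡0 = ⊥-elim (p≢0 p≡0)
... | no p≢0′ = *-inverseˡ p {{≢-nonZero p≢0′}}

module Pivoting {n} (c : Config n) {i j : Fin n}
                (bi : Basic c i) (nj : NonBasic c j) (a≢0 : A c i j ≢ 0ℚ) where

  private
    c′ = pivoted c i j
    a  = A c i j

  i≢j : i ≢ j
  i≢j refl = Basic⇒¬NonBasic c bi nj

  pivoted-basic : ∀ {r} → Basic c′ r → r ≡ j ⊎ (Basic c r × r ≢ i)
  pivoted-basic {r} br′ with r ≟ i | r ≟ j
  ... | yes _   | _       with () ← br′
  ... | no _    | yes r≡j = inj₁ r≡j
  ... | no r≢i  | no _    = inj₂ (br′ , r≢i)

  rowForm-entering : rowForm c′ j ≗ λ k → - inv a * rowForm c i k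
  rowForm-entering k with k ≟ j | k ≟ i | j ≟ j | basic c k in bk
  ... | _        | _        | no j≢j | _     = ⊥-elim (j≢j refl)
  ... | yes k≡j  | yes k≡i  | yes _  | _     = ⊥-elim (i≢j (trans (sym k≡i) k≡j))
  ... | yes refl | no _     | yes _  | true  = ⊥-elim (Basic⇒¬NonBasic c bk nj)
  ... | yes refl | no _     | yes _  | false = begin
    - 1ℚ             ≡⟨ cong -_ (sym (inv-inverseˡ a a≢0)) ⟩
    - (inv a * a)    ≡⟨ neg-distribˡ-* (inv a) a ⟩
    - inv a * a      ∎
  ... | no _     | yes refl | yes _  | _     = solve 1 (λ x → x := :- x :* :- con 1ℚ) refl (inv a)
  ... | no _     | no _     | yes _  | true  = sym (*-zeroʳ (- inv a))
  ... | no _     | no _     | yes _  | false = solve 2 (λ x y → :- (y :* x) := :- x :* y) refl (inv a) (A c i k)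

  rowForm-remaining : ∀ {r} → Basic c r → r ≢ i →
                  rowForm c′ r ≗ λ k → rowForm c r k + - (A c r j * inv a) * rowForm c i k
  rowForm-remaining {r} br r≢i k rewrite br with k ≟ r | k ≟ i | k ≟ j | r ≟ j | r ≟ i | basic c k in bk
  ... | _        | _        | _        | yes refl | _       | _     = ⊥-elim (Basic⇒¬NonBasic c br nj)
  ... | _        | _        | _        | no _     | yes r≡i | _     = ⊥-elim (r≢i r≡i)
  ... | yes refl | yes k≡i  | _        | no _     | no _    | _     = ⊥-elim (r≢i k≡i)
  ... | yes refl | no _     | _        | no _     | no _    | true  =
    solve 1 (λ x → :- con 1ℚ := :- con 1ℚ :+ :- x :* con 0ℚ) refl (A c r j * inv a)
  ... | yes refl | no _     | _        | no _     | no _    | false = ⊥-elim (Basic⇒¬NonBasic c br bk)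
  ... | no _     | yes refl | _        | no _     | no _    | true  =
    solve 1 (λ x → x := con 0ℚ :+ :- x :* :- con 1ℚ) refl (A c r j * inv a)
  ... | no _     | yes refl | _        | no _     | no _    | false = ⊥-elim (Basic⇒¬NonBasic c bi bk)
  ... | no _     | no _     | yes refl | no _     | no _    | true  = ⊥-elim (Basic⇒¬NonBasic c bk nj)
  ... | no _     | no _     | yes refl | no _     | no _    | false = begin
    0ℚ
      ≡⟨ solve 1 (λ x → con 0ℚ := x :+ :- (x :* con 1ℚ)) refl (A c r k) ⟩
    A c r k + - (A c r k * 1ℚ)
      ≡⟨ cong (λ y → A c r k + - (A c r k * y)) (sym (inv-inverseˡ a a≢0)) ⟩
    A c r k + - (A c r k * (inv a * a))
      ≡⟨ solve 3 (λ x y z → x :+ :- (x :* (y :* z)) := x :+ :- (x :* y) :* z) refl (A c r k) (inv a) a ⟩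
    A c r k + - (A c r k * inv a) * a
      ∎
  ... | no _     | no _     | no _     | no _     | no _    | true  =
    solve 1 (λ x → con 0ℚ := con 0ℚ :+ :- x :* con 0ℚ) refl (A c r j * inv a)
  ... | no _     | no _     | no _     | no _     | no _    | false =
    solve 4 (λ x y z w → x :- y :* z :* w := x :+ :- (y :* w) :* z)
            refl (A c r k) (A c r j) (A c i k) (inv a)

  pivoted-preserves-TableauSat : TableauSat c → TableauSat c′
  pivoted-preserves-TableauSat sat r br′ =
    rowForm·≡0⇒row-equation c′ br′ (rowForm′·α≡0 (pivoted-basic br′))
    where
    rowForm·α≡0 : ∀ {r} → Basic c r → rowForm c r · α c ≡ 0ℚ
    rowForm·α≡0 = SatisfiesTableau⇒rowForm·≡0 c sat

    rowForm′·α≡0 : r ≡ j ⊎ (Basic c r × r ≢ i) → rowForm c′ r · α c ≡ 0ℚ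
    rowForm′·α≡0 (inj₁ refl) = begin
      rowForm c′ j · α c                     ≡⟨ ·-congˡ rowForm-entering ⟩
      (λ k → - inv a * rowForm c i k) · α c  ≡⟨ ·-*ˡ (- inv a) (rowForm c i) ⟩
      - inv a * (rowForm c i · α c)          ≡⟨ cong (- inv a *_) (rowForm·α≡0 bi) ⟩
      - inv a * 0ℚ                           ≡⟨ *-zeroʳ (- inv a) ⟩
      0ℚ                                     ∎
    rowForm′·α≡0 (inj₂ (br , r≢i)) = begin
      rowForm c′ r · α c
        ≡⟨ ·-congˡ (rowForm-remaining br r≢i) ⟩
      (λ k → rowForm c r k + - cr * rowForm c i k) · α c
        ≡⟨ ·-+ˡ (rowForm c r) (λ k → - cr * rowForm c i k) ⟩
      rowForm c r · α c + (λ k → - cr * rowForm c i k) · α c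
        ≡⟨ cong (rowForm c r · α c +_) (·-*ˡ (- cr) (rowForm c i)) ⟩
      rowForm c r · α c + - cr * (rowForm c i · α c)
        ≡⟨ cong₂ (λ x y → x + - cr * y) (rowForm·α≡0 br) (rowForm·α≡0 bi) ⟩
      0ℚ + - cr * 0ℚ
        ≡⟨ solve 1 (λ x → con 0ℚ :+ x :* con 0ℚ := con 0ℚ) refl (- cr) ⟩
      0ℚ
        ∎
      where cr = A c r j * inv a

≮̄⇒≥̄ : ∀ {x y} → ¬ (x <̄ y) → y ≤̄ x
≮̄⇒≥̄ { -∞}    { -∞}    _   = -∞≤
≮̄⇒≥̄ { -∞}    {fin _} x≮y = ⊥-elim (x≮y -∞<fin)
≮̄⇒≥̄ { -∞}    {+∞}    x≮y = ⊥-elim (x≮y -∞<+∞)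
≮̄⇒≥̄ {fin _} { -∞}    _   = -∞≤
≮̄⇒≥̄ {fin _} {fin _} x≮y = fin≤fin (≮⇒≥ (x≮y ∘ fin<fin))
≮̄⇒≥̄ {fin _} {+∞}    x≮y = ⊥-elim (x≮y fin<+∞)
≮̄⇒≥̄ {+∞}           _   = ≤+∞

≤̄-<̄-trans : ∀ {x y z} → x ≤̄ y → y <̄ z → x <̄ z
≤̄-<̄-trans -∞≤           -∞<fin       = -∞<fin
≤̄-<̄-trans -∞≤           -∞<+∞        = -∞<+∞
≤̄-<̄-trans -∞≤           (fin<fin _)  = -∞<fin
≤̄-<̄-trans -∞≤           fin<+∞       = -∞<+∞
≤̄-<̄-trans (fin≤fin p≤q) (fin<fin q<r) = fin<fin (≤-<-trans p≤q q<r)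
≤̄-<̄-trans (fin≤fin _)   fin<+∞       = fin<+∞

<̄-≤̄-trans : ∀ {x y z} → x <̄ y → y ≤̄ z → x <̄ z
<̄-≤̄-trans -∞<fin       (fin≤fin _)   = -∞<fin
<̄-≤̄-trans -∞<fin       ≤+∞           = -∞<+∞
<̄-≤̄-trans -∞<+∞        ≤+∞           = -∞<+∞
<̄-≤̄-trans (fin<fin p<q) (fin≤fin q≤r) = fin<fin (<-≤-trans p<q q≤r)
<̄-≤̄-trans (fin<fin _)  ≤+∞           = fin<+∞
<̄-≤̄-trans fin<+∞       ≤+∞           = fin<+∞

module _ {a : ℚ} where

  scale-pos : 0ℚ < a → scale a -∞ ≡ -∞ × scale a +∞ ≡ +∞
  scale-pos 0<a = cong (λ b → if b then -∞ else +∞) 0<a? , cong (λ b → if b then +∞ else -∞) 0<a?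
    where 0<a? = dec-true (0ℚ <? a) 0<a

  scale-neg : a < 0ℚ → scale a -∞ ≡ +∞ × scale a +∞ ≡ -∞
  scale-neg a<0 = cong (λ b → if b then -∞ else +∞) 0<a? , cong (λ b → if b then +∞ else -∞) 0<a?
    where 0<a? = dec-false (0ℚ <? a) (<-asym a<0)

  scale-mono-≤̄ : ∀ {x y} → 0ℚ < a → x ≤̄ y → scale a x ≤̄ scale a y
  scale-mono-≤̄ 0<a (-∞≤ {y})    = subst (_≤̄ scale a y) (sym (proj₁ (scale-pos 0<a))) -∞≤
  scale-mono-≤̄ 0<a (≤+∞ {x})    = subst (scale a x ≤̄_) (sym (proj₂ (scale-pos 0<a))) ≤+∞
  scale-mono-≤̄ 0<a (fin≤fin p≤q) = fin≤fin (*-monoˡ-≤-nonNeg a {{pos⇒nonNeg a {{positive 0<a}}}} p≤q)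

  scale-antimono-≤̄ : ∀ {x y} → a < 0ℚ → x ≤̄ y → scale a y ≤̄ scale a x
  scale-antimono-≤̄ a<0 (-∞≤ {y})    = subst (scale a y ≤̄_) (sym (proj₁ (scale-neg a<0))) ≤+∞
  scale-antimono-≤̄ a<0 (≤+∞ {x})    = subst (_≤̄ scale a x) (sym (proj₂ (scale-neg a<0))) -∞≤
  scale-antimono-≤̄ a<0 (fin≤fin p≤q) = fin≤fin (*-monoˡ-≤-nonPos a {{neg⇒nonPos a {{negative a<0}}}} p≤q)

⊕⁺-≤̄ : ∀ {x y p q} → x ≤̄ fin p → y ≤̄ fin q → x ⊕⁺ y ≤̄ fin (p + q)
⊕⁺-≤̄ -∞≤         -∞≤         = -∞≤
⊕⁺-≤̄ -∞≤         (fin≤fin _) = -∞≤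
⊕⁺-≤̄ (fin≤fin _) -∞≤         = -∞≤
⊕⁺-≤̄ (fin≤fin p) (fin≤fin q) = fin≤fin (+-mono-≤ p q)

⊕⁻-≥̄ : ∀ {x y p q} → fin p ≤̄ x → fin q ≤̄ y → fin (p + q) ≤̄ x ⊕⁻ y
⊕⁻-≥̄ ≤+∞         ≤+∞         = ≤+∞
⊕⁻-≥̄ ≤+∞         (fin≤fin _) = ≤+∞
⊕⁻-≥̄ (fin≤fin _) ≤+∞         = ≤+∞
⊕⁻-≥̄ (fin≤fin p) (fin≤fin q) = fin≤fin (+-mono-≤ p q)

Σ⁺-≤̄-sum : ∀ {n} {f : Vector ℚ̄ n} {g : Vector ℚ n} → (∀ k → f k ≤̄ fin (g k)) → Σ⁺ f ≤̄ fin (sum g)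
Σ⁺-≤̄-sum {f = f} {g} f≤g =
  subst (_≤̄ fin (sum g)) (sym (foldr-allFin _⊕⁺_ (fin 0ℚ) f)) (foldr-≤̄ f≤g)
  where
  foldr-≤̄ : ∀ {n} {f : Vector ℚ̄ n} {g} → (∀ k → f k ≤̄ fin (g k)) →
            Vector.foldr _⊕⁺_ (fin 0ℚ) f ≤̄ fin (sum g)
  foldr-≤̄ {zero}  f≤g = fin≤fin ≤-refl
  foldr-≤̄ {suc n} f≤g = ⊕⁺-≤̄ (f≤g zero) (foldr-≤̄ (f≤g ∘ suc))

Σ⁻-≥̄-sum : ∀ {n} {f : Vector ℚ̄ n} {g : Vector ℚ n} → (∀ k → fin (g k) ≤̄ f k) → fin (sum g) ≤̄ Σ⁻ f
Σ⁻-≥̄-sum {f = f} {g} g≤f =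
  subst (fin (sum g) ≤̄_) (sym (foldr-allFin _⊕⁻_ (fin 0ℚ) f)) (foldr-≥̄ g≤f)
  where
  foldr-≥̄ : ∀ {n} {f : Vector ℚ̄ n} {g} → (∀ k → fin (g k) ≤̄ f k) →
            fin (sum g) ≤̄ Vector.foldr _⊕⁻_ (fin 0ℚ) f
  foldr-≥̄ {zero}  g≤f = fin≤fin ≤-refl
  foldr-≥̄ {suc n} g≤f = ⊕⁻-≥̄ (g≤f zero) (foldr-≥̄ (g≤f ∘ suc))

-- The decisions are abstracted because `with 0ℚ <? a` cannot find `does (0ℚ <? a)` in a goal:
-- it unfolds to a comparison of integers.
sign-elim : ∀ {a x y} (P : ℚ̄ → Set) (pos? : Dec (0ℚ < a)) (neg? : Dec (a < 0ℚ)) →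
            (0ℚ < a → P x) → (a < 0ℚ → P y) → (a ≡ 0ℚ → P (fin 0ℚ)) →
            P (if does pos? then x else if does neg? then y else fin 0ℚ)
sign-elim P (yes 0<a) _         pos _   _    = pos 0<a
sign-elim P (no _)    (yes a<0) _   neg _    = neg a<0
sign-elim P (no 0≮a)  (no a≮0)  _   _   null = null (≤-antisym (≮⇒≥ 0≮a) (≮⇒≥ a≮0))

module _ {n} (c : Config n) (i : Fin n) where

  upperTerm : Fin n → ℚ̄
  upperTerm k = if basic c k then fin 0ℚ
                else if does (0ℚ <? A c i k) then scale (A c i k) (u c k)
                else if does (A c i k <? 0ℚ) then scale (A c i k) (l c k)
                else fin 0ℚ

  lowerTerm : Fin n → ℚ̄
  lowerTerm k = if basic c k then fin 0ℚ
                else if does (0ℚ <? A c i k) then scale (A c i k) (l c k)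
                else if does (A c i k <? 0ℚ) then scale (A c i k) (u c k)
                else fin 0ℚ

  upperTerm-≤̄ : (∀ k → ¬ slack⁺ c i k) → ∀ k → upperTerm k ≤̄ fin (rowTerm c i (α c) k)
  upperTerm-≤̄ tight k with basic c k in bk
  ... | true  = fin≤fin ≤-refl
  ... | false = sign-elim (_≤̄ fin (A c i k * α c k)) (0ℚ <? A c i k) (A c i k <? 0ℚ)
    (λ 0<a → scale-mono-≤̄ 0<a (≮̄⇒≥̄ λ α<u → tight k (bk , inj₁ (0<a , α<u))))
    (λ a<0 → scale-antimono-≤̄ a<0 (≮̄⇒≥̄ λ l<α → tight k (bk , inj₂ (a<0 , l<α))))
    (λ a≡0 → fin≤fin (≤-reflexive (sym (trans (cong (_* α c k) a≡0) (*-zeroˡ (α c k))))))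

  lowerTerm-≥̄ : (∀ k → ¬ slack⁻ c i k) → ∀ k → fin (rowTerm c i (α c) k) ≤̄ lowerTerm k
  lowerTerm-≥̄ tight k with basic c k in bk
  ... | true  = fin≤fin ≤-refl
  ... | false = sign-elim (fin (A c i k * α c k) ≤̄_) (0ℚ <? A c i k) (A c i k <? 0ℚ)
    (λ 0<a → scale-mono-≤̄ 0<a (≮̄⇒≥̄ λ l<α → tight k (bk , inj₂ (0<a , l<α))))
    (λ a<0 → scale-antimono-≤̄ a<0 (≮̄⇒≥̄ λ α<u → tight k (bk , inj₁ (a<0 , α<u))))
    (λ a≡0 → fin≤fin (≤-reflexive (trans (cong (_* α c k) a≡0) (*-zeroˡ (α c k)))))

  α≡sum-rowTerm : TableauSat c → Basic c i → α c i ≡ sum (rowTerm c i (α c))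
  α≡sum-rowTerm sat bi = trans (sat i bi) (Σℚ≡sum (rowTerm c i (α c)))

  impliedUpper-≤̄-α : TableauSat c → Basic c i → (∀ k → ¬ slack⁺ c i k) →
                     impliedUpper c i ≤̄ fin (α c i)
  impliedUpper-≤̄-α sat bi tight =
    subst (impliedUpper c i ≤̄_) (cong fin (sym (α≡sum-rowTerm sat bi))) (Σ⁺-≤̄-sum (upperTerm-≤̄ tight))

  α-≤̄-impliedLower : TableauSat c → Basic c i → (∀ k → ¬ slack⁻ c i k) →
                     fin (α c i) ≤̄ impliedLower c i
  α-≤̄-impliedLower sat bi tight =
    subst (_≤̄ impliedLower c i) (cong fin (sym (α≡sum-rowTerm sat bi))) (Σ⁻-≥̄-sum (lowerTerm-≥̄ tight))

failure⇒Conflict : ∀ {n} {c : Config n} → TableauSat c → ⟨ c ⟩ ⟶ UNSAT → ∃[ i ] Conflict c i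
failure⇒Conflict {c = c} sat (failure₁ {i = i} bi (inj₁ (α<l , tight))) =
  i , inj₂ (inj₁ (bi , ≤̄-<̄-trans (impliedUpper-≤̄-α c i sat bi tight) α<l))
failure⇒Conflict {c = c} sat (failure₁ {i = i} bi (inj₂ (u<α , tight))) =
  i , inj₂ (inj₂ (bi , <̄-≤̄-trans u<α (α-≤̄-impliedLower c i sat bi tight)))
failure⇒Conflict sat (failure₂ {i = i} u<l) = i , inj₁ u<l

slack⁺⇒A≢0 : ∀ {n} {c : Config n} {i j} → slack⁺ c i j → A c i j ≢ 0ℚ
slack⁺⇒A≢0 (_ , inj₁ (0<a , _)) a≡0 = <⇒≢ 0<a (sym a≡0)
slack⁺⇒A≢0 (_ , inj₂ (a<0 , _)) a≡0 = <⇒≢ a<0 a≡0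

slack⁻⇒A≢0 : ∀ {n} {c : Config n} {i j} → slack⁻ c i j → A c i j ≢ 0ℚ
slack⁻⇒A≢0 (_ , inj₁ (a<0 , _)) a≡0 = <⇒≢ a<0 a≡0
slack⁻⇒A≢0 (_ , inj₂ (0<a , _)) a≡0 = <⇒≢ 0<a (sym a≡0)

⟶-preserves-TableauSat : ∀ {n} {c c′ : Config n} → TableauSat c → ⟨ c ⟩ ⟶ ⟨ c′ ⟩ → TableauSat c′
⟶-preserves-TableauSat {c = c} sat (pivot₁ bi _ sl) =
  Pivoting.pivoted-preserves-TableauSat c bi (proj₁ sl) (slack⁺⇒A≢0 {c = c} sl) sat
⟶-preserves-TableauSat {c = c} sat (pivot₂ bi _ sl) =
  Pivoting.pivoted-preserves-TableauSat c bi (proj₁ sl) (slack⁻⇒A≢0 {c = c} sl) sat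
⟶-preserves-TableauSat {c = c} sat (update δ nj _ _ _) = updated-preserves-TableauSat {c = c} δ nj sat

last-configuration : ∀ {n} (P : Config n → Set) → (∀ {c c′} → P c → ⟨ c ⟩ ⟶ ⟨ c′ ⟩ → P c′) →
                     ∀ {c₀} → P c₀ → ⟨ c₀ ⟩ ⟶* UNSAT →
                     ∃[ c ] (⟨ c₀ ⟩ ⟶* ⟨ c ⟩ × ⟨ c ⟩ ⟶ UNSAT × P c)
last-configuration P preserves p (_◅_ {j = ⟨ c ⟩} step run) =
  let (c′ , run′ , failure , p′) = last-configuration P preserves (preserves p step) run
  in  c′ , step ◅ run′ , failure , p′
last-configuration P preserves {c₀} p (_◅_ {j = UNSAT} failure _) = c₀ , ε , failure , p
last-configuration P preserves p (_◅_ {j = SAT} _ (() ◅ _))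

lemma1 : (n : ℕ) (c₀ : Config n) → TableauSat c₀ → ⟨ c₀ ⟩ ⟶* UNSAT →
    ∃[ c ] (⟨ c₀ ⟩ ⟶* ⟨ c ⟩ × ⟨ c ⟩ ⟶ UNSAT × ∃[ i ] Conflict c i)
lemma1 n c₀ sat run =
  let (c , run′ , failure , sat′) = last-configuration TableauSat ⟶-preserves-TableauSat sat run
  in  c , run′ , failure , failure⇒Conflict sat′ failure
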